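{- Let $n\geqslant1$, $X\subseteq\mathbb{Z}_n\setminus\{0\}$, $Y\subseteq\mathbb{Z}_n$. Then $Dih(n,X,Y)$ is a DSRG with parameters $(2n,|X|+|Y|,\mu,\lambda,t)$ if and only if, in the group ring $\mathbb{Z}[C_n]$, (i) $\overline{x^Y}\,\Delta_1=(\lambda-\mu)\overline{x^Y}+\mu\overline{C_n}$, and (ii) $\overline{x^X}\,\Delta_1+\Delta_2=\overline{x^X}^{\,2}+\overline{x^Y}\;\overline{x^{ -Y}}=(t-\mu)e+(\lambda-\mu)\overline{x^X}+\mu\overline{C_n}$, where $\Delta_1=\overline{x^X}+\overline{x^{ -X}}$ and $\Delta_2=\overline{x^Y}\;\overline{x^{ -Y}}-\overline{x^X}\;\overline{x^{ -X}}$.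
   Context: $D_n=\langle x,a\mid x^n=1,\ a^2=1,\ ax=x^{ -1}a\rangle$ and $C_n=\langle x\rangle$ with identity $e$. $Dih(n,X,Y)$ is the Cayley digraph on $D_n$ with connection set $\{x^i:i\in X\}\cup\{x^ja:j\in Y\}$ (arc $g\to h$ iff $g^{ -1}h$ is in it). A DSRG with parameters $(N,k,\mu,\lambda,t)$ is a digraph on $N$ vertices with adjacency matrix $A$ satisfying $AJ=JA=kJ$ and $A^2=tI+\lambda A+\mu(J-I-A)$. For $A\subseteq\mathbb{Z}_n$, $\overline{x^A}=\sum_{i\in A}x^i\in\mathbb{Z}[C_n]$, $-A=\{ -i:i\in A\}$, and $\overline{C_n}=\sum_{g\in C_n}g$. -}

module Defs where

open import Data.Nat as ℕ using (ℕ; suc; NonZero)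
open import Data.Nat.DivMod using (_%_; m%n<n)
open import Data.Integer as ℤ using (ℤ; 0ℤ; 1ℤ; +_)
open import Data.Fin as Fin using (Fin; toℕ; fromℕ<)
open import Data.Fin.Subset using (Subset)
open import Data.Bool using (Bool; true; false; if_then_else_; _xor_)
open import Data.Vec using (lookup)
open import Data.List using (List; map; foldr)
open import Data.List using (allFin)
open import Data.Product using (_×_; _,_)
open import Relation.Binary.PropositionalEquality using (_≡_)
open import Relation.Nullary using (does)

-- Arithmetic in ℤ_n, with ℤ_n represented by Fin n (n = suc m ≥ 1)

_⊕_ : ∀ {m} → Fin (suc m) → Fin (suc m) → Fin (suc m)
_⊕_ {m} i j = fromℕ< (m%n<n (toℕ i ℕ.+ toℕ j) (suc m))

⊖_ : ∀ {m} → Fin (suc m) → Fin (suc m)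
⊖_ {m} i = fromℕ< (m%n<n (suc m ℕ.∸ toℕ i) (suc m))

Σ : ∀ {n} → (Fin n → ℤ) → ℤ
Σ {n} f = foldr ℤ._+_ 0ℤ (map f (allFin n))

[_∈_] : ∀ {n} → Fin n → Subset n → ℤ
[ i ∈ A ] = if lookup A i then 1ℤ else 0ℤ

card : ∀ {n} → Subset n → ℕ
card {n} A = foldr ℕ._+_ 0 (map (λ i → if lookup A i then 1 else 0) (allFin n))

-- The dihedral group D_n: the element x^i a^s is represented by (i , s),
-- s = false meaning a^0 and s = true meaning a^1.
-- Multiplication: (x^i a^s)(x^j a^r) = x^(i + (-1)^s j) a^(s+r).

D : ℕ → Set
D m = Fin (suc m) × Bool

_·_ : ∀ {m} → D m → D m → D m
(i , false) · (j , r) = (i ⊕ j , r)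
(i , true)  · (j , r) = (i ⊕ (⊖ j) , true xor r)

inv : ∀ {m} → D m → D m
inv (i , false) = (⊖ i , false)
inv (i , true)  = (i , true)

-- membership in the connection set {x^i : i ∈ X} ∪ {x^j a : j ∈ Y}
inS : ∀ {m} → Subset (suc m) → Subset (suc m) → D m → Bool
inS X Y (i , false) = lookup X i
inS X Y (j , true)  = lookup Y j

Adj : ∀ {m} → Subset (suc m) → Subset (suc m) → D m → D m → ℤ
Adj X Y g h = if inS X Y (inv g · h) then 1ℤ else 0ℤ

ΣD : ∀ {m} → (D m → ℤ) → ℤ
ΣD f = Σ (λ i → f (i , false)) ℤ.+ Σ (λ i → f (i , true))

δ : ∀ {m} → D m → D m → ℤ
δ (i , s) (j , r) = if does (i Fin.≟ j) ∧' eqB s r then 1ℤ else 0ℤ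
  where
    _∧'_ : Bool → Bool → Bool
    true ∧' b = b
    false ∧' _ = false
    eqB : Bool → Bool → Bool
    eqB true true = true
    eqB false false = true
    eqB _ _ = false

record IsDSRG {m} (M : D m → D m → ℤ) (N k μ λ' t : ℕ) : Set where
  field
    order : N ≡ 2 ℕ.* suc m
    rowSum : ∀ g → ΣD (λ h → M g h) ≡ + k
    colSum : ∀ h → ΣD (λ g → M g h) ≡ + k
    square : ∀ g h →
      ΣD (λ z → M g z ℤ.* M z h)
        ≡ (+ t) ℤ.* δ g h ℤ.+ (+ λ') ℤ.* M g h
          ℤ.+ (+ μ) ℤ.* (1ℤ ℤ.- δ g h ℤ.- M g h)

Dih : ∀ m → Subset (suc m) → Subset (suc m) → D m → D m → ℤ
Dih m X Y = Adj X Y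

-- The group ring ℤ[C_n]: Σ_i c_i x^i represented by i ↦ c_i.

ZC : ℕ → Set
ZC m = Fin (suc m) → ℤ

_≈_ : ∀ {m} → ZC m → ZC m → Set
f ≈ g = ∀ i → f i ≡ g i

_+ᶻ_ : ∀ {m} → ZC m → ZC m → ZC m
(f +ᶻ g) i = f i ℤ.+ g i

_-ᶻ_ : ∀ {m} → ZC m → ZC m → ZC m
(f -ᶻ g) i = f i ℤ.- g i

_*ᶻ_ : ∀ {m} → ZC m → ZC m → ZC m
(f *ᶻ g) k = Σ (λ i → f i ℤ.* g (k ⊕ (⊖ i)))

_·ᶻ_ : ∀ {m} → ℤ → ZC m → ZC m
(c ·ᶻ f) i = c ℤ.* f i

xbar : ∀ {m} → Subset (suc m) → ZC m
xbar A i = [ i ∈ A ]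

xbarNeg : ∀ {m} → Subset (suc m) → ZC m
xbarNeg A i = [ ⊖ i ∈ A ]

eᶻ : ∀ {m} → ZC m
eᶻ i = if does (i Fin.≟ Fin.zero) then 1ℤ else 0ℤ

Cbar : ∀ {m} → ZC m
Cbar _ = 1ℤ

Δ₁ : ∀ {m} → Subset (suc m) → ZC m
Δ₁ X = xbar X +ᶻ xbarNeg X

Δ₂ : ∀ {m} → Subset (suc m) → Subset (suc m) → ZC m
Δ₂ X Y = (xbar Y *ᶻ xbarNeg Y) -ᶻ (xbar X *ᶻ xbarNeg X)

-- Dih(n,X,Y) is the Cayley digraph of D_n with connection set S = x^X ∪ x^Y a: its
-- adjacency matrix is A(g,h) = 1_S(g⁻¹h). Hence it is (|X|+|Y|)-regular, and the
-- substitution z = g u gives A²(g,h) = (S̄ S̄)(g⁻¹h) in ℤ[D_n], so the DSRG equation says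
-- S̄² = t e + λ S̄ + μ (D̄_n − e − S̄). Writing elements of ℤ[D_n] as α + β a with
-- α, β ∈ ℤ[C_n], the relation a x^i = x^(-i) a gives
--   (α + β a)(γ + δ a) = (α γ + β δ⁻) + (α δ + β γ⁻) a,   where f⁻(x) = f(x⁻¹).
-- Comparing the C_n-parts and the C_n a-parts of (x^X + x^Y a)² with the right-hand side
-- yields (ii) and (i); the first equality in (ii) holds identically in ℤ[C_n].
module Submission where

open import Defs
open import Data.Nat using (ℕ; suc; _*_; _+_)
open import Data.Integer using (+_; _-_)
open import Data.Fin using (zero)
open import Data.Fin.Subset using (Subset)
open import Data.Bool using (false)
open import Data.Vec using (lookup)
open import Data.Product using (_×_)
open import Function.Bundles using (_⇔_)
open import Relation.Binary.PropositionalEquality using (_≡_)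

open import Algebra.Bundles using (AbelianGroup; Group)
import Algebra.Properties.AbelianGroup as AbelianGroupProperties
import Algebra.Properties.CommutativeMonoid.Sum as CommutativeMonoidSum
import Algebra.Properties.Group as GroupProperties
open import Data.Bool as Bool using (true; if_then_else_; not)
open import Data.Bool.Properties using (not-involutive)
open import Data.Empty using (⊥-elim)
open import Data.Fin as Fin using (Fin; toℕ; _≟_)
open import Data.Fin.Permutation using (permutation)
open import Data.Fin.Properties using (toℕ-fromℕ<; toℕ-injective; toℕ<n)
open import Data.Integer using (ℤ; 0ℤ; 1ℤ)
import Data.Integer as ℤ
import Data.Integer.Properties as ℤP
open import Data.Integer.Tactic.RingSolver using (solve-∀)
open import Data.List using (List; []; _∷_; map; foldr; tabulate; allFin)
open import Data.List.Properties using (map-tabulate)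
open import Data.Nat as ℕ using (NonZero)
import Data.Nat.Properties as ℕP
open import Data.Nat.DivMod using (_%_; %-distribˡ-+; m%n%n≡m%n; m<n⇒m%n≡m; n%n≡0)
open import Data.Product using (_,_)
open import Data.Product.Properties using (≡-dec)
open import Function using (_∘_; id)
open import Function.Bundles using (mk⇔; Equivalence)
open import Relation.Binary.Definitions using (DecidableEquality)
open import Relation.Binary.PropositionalEquality
  using (_≢_; refl; sym; trans; cong; cong₂; _≗_; isEquivalence; module ≡-Reasoning)
open import Relation.Nullary using (yes; no)
open import Relation.Nullary.Decidable using (dec-true)

open ≡-Reasoning

[m%n+o]%n≡[m+o]%n : ∀ m o n .{{_ : NonZero n}} → (m % n + o) % n ≡ (m + o) % n
[m%n+o]%n≡[m+o]%n m o n = begin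
  (m % n + o) % n          ≡⟨ %-distribˡ-+ (m % n) o n ⟩
  (m % n % n + o % n) % n  ≡⟨ cong (λ x → (x + o % n) % n) (m%n%n≡m%n m n) ⟩
  (m % n + o % n) % n      ≡⟨ %-distribˡ-+ m o n ⟨
  (m + o) % n              ∎

module _ {m : ℕ} where

  toℕ-⊕ : (i j : Fin (suc m)) → toℕ (i ⊕ j) ≡ (toℕ i + toℕ j) % suc m
  toℕ-⊕ i j = toℕ-fromℕ< _

  toℕ-⊖ : (i : Fin (suc m)) → toℕ (⊖ i) ≡ (suc m ℕ.∸ toℕ i) % suc m
  toℕ-⊖ i = toℕ-fromℕ< _

  toℕ-[⊕]⊕ : (i j k : Fin (suc m)) → toℕ ((i ⊕ j) ⊕ k) ≡ (toℕ i + toℕ j + toℕ k) % suc m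
  toℕ-[⊕]⊕ i j k = begin
    toℕ ((i ⊕ j) ⊕ k)                       ≡⟨ toℕ-⊕ (i ⊕ j) k ⟩
    (toℕ (i ⊕ j) + toℕ k) % suc m           ≡⟨ cong (λ x → (x + toℕ k) % suc m) (toℕ-⊕ i j) ⟩
    ((toℕ i + toℕ j) % suc m + toℕ k) % suc m ≡⟨ [m%n+o]%n≡[m+o]%n (toℕ i + toℕ j) (toℕ k) (suc m) ⟩
    (toℕ i + toℕ j + toℕ k) % suc m         ∎

  ⊕-comm : (i j : Fin (suc m)) → i ⊕ j ≡ j ⊕ i
  ⊕-comm i j = toℕ-injective (begin
    toℕ (i ⊕ j)             ≡⟨ toℕ-⊕ i j ⟩
    (toℕ i + toℕ j) % suc m ≡⟨ cong (_% suc m) (ℕP.+-comm (toℕ i) (toℕ j)) ⟩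
    (toℕ j + toℕ i) % suc m ≡⟨ toℕ-⊕ j i ⟨
    toℕ (j ⊕ i)             ∎)

  ⊕-assoc : (i j k : Fin (suc m)) → (i ⊕ j) ⊕ k ≡ i ⊕ (j ⊕ k)
  ⊕-assoc i j k = toℕ-injective (begin
    toℕ ((i ⊕ j) ⊕ k)               ≡⟨ toℕ-[⊕]⊕ i j k ⟩
    (toℕ i + toℕ j + toℕ k) % suc m ≡⟨ cong (_% suc m) rotate ⟩
    (toℕ j + toℕ k + toℕ i) % suc m ≡⟨ toℕ-[⊕]⊕ j k i ⟨
    toℕ ((j ⊕ k) ⊕ i)               ≡⟨ cong toℕ (⊕-comm (j ⊕ k) i) ⟩
    toℕ (i ⊕ (j ⊕ k))               ∎)
    where
    rotate : toℕ i + toℕ j + toℕ k ≡ toℕ j + toℕ k + toℕ i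
    rotate = trans (ℕP.+-assoc (toℕ i) (toℕ j) (toℕ k)) (ℕP.+-comm (toℕ i) (toℕ j + toℕ k))

  ⊕-identityˡ : (i : Fin (suc m)) → zero ⊕ i ≡ i
  ⊕-identityˡ i = toℕ-injective (trans (toℕ-⊕ zero i) (m<n⇒m%n≡m (toℕ<n i)))

  ⊕-inverseˡ : (i : Fin (suc m)) → (⊖ i) ⊕ i ≡ zero
  ⊕-inverseˡ i = toℕ-injective (begin
    toℕ ((⊖ i) ⊕ i)                               ≡⟨ toℕ-⊕ (⊖ i) i ⟩
    (toℕ (⊖ i) + toℕ i) % suc m                   ≡⟨ cong (λ x → (x + toℕ i) % suc m) (toℕ-⊖ i) ⟩
    ((suc m ℕ.∸ toℕ i) % suc m + toℕ i) % suc m   ≡⟨ [m%n+o]%n≡[m+o]%n (suc m ℕ.∸ toℕ i) (toℕ i) (suc m) ⟩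
    (suc m ℕ.∸ toℕ i + toℕ i) % suc m             ≡⟨ cong (_% suc m) (ℕP.m∸n+n≡m (ℕP.<⇒≤ (toℕ<n i))) ⟩
    suc m % suc m                                 ≡⟨ n%n≡0 (suc m) ⟩
    0                                             ∎)

  ⊕-identityʳ : (i : Fin (suc m)) → i ⊕ zero ≡ i
  ⊕-identityʳ i = trans (⊕-comm i zero) (⊕-identityˡ i)

  ⊕-inverseʳ : (i : Fin (suc m)) → i ⊕ (⊖ i) ≡ zero
  ⊕-inverseʳ i = trans (⊕-comm i (⊖ i)) (⊕-inverseˡ i)

  ℤₙ-abelianGroup : AbelianGroup _ _
  ℤₙ-abelianGroup = record
    { Carrier = Fin (suc m)
    ; _≈_ = _≡_
    ; _∙_ = _⊕_
    ; ε = zero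
    ; _⁻¹ = ⊖_
    ; isAbelianGroup = record
      { isGroup = record
        { isMonoid = record
          { isSemigroup = record
            { isMagma = record { isEquivalence = isEquivalence ; ∙-cong = cong₂ _⊕_ }
            ; assoc = ⊕-assoc
            }
          ; identity = ⊕-identityˡ , ⊕-identityʳ
          }
        ; inverse = ⊕-inverseˡ , ⊕-inverseʳ
        ; ⁻¹-cong = cong ⊖_
        }
      ; comm = ⊕-comm
      }
    }

  module ℤₙ = AbelianGroupProperties ℤₙ-abelianGroup

module _ {m : ℕ} where

  εᴰ : D m
  εᴰ = (zero , false)

  ·-assoc : (g h k : D m) → (g · h) · k ≡ g · (h · k)
  ·-assoc (i , false) (j , false) (k , r) = cong (_, r) (⊕-assoc i j k)
  ·-assoc (i , false) (j , true)  (k , r) = cong (_, not r) (⊕-assoc i j (⊖ k))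
  ·-assoc (i , true)  (j , false) (k , r) = cong (_, not r) (begin
    (i ⊕ (⊖ j)) ⊕ (⊖ k)  ≡⟨ ⊕-assoc i (⊖ j) (⊖ k) ⟩
    i ⊕ ((⊖ j) ⊕ (⊖ k))  ≡⟨ cong (i ⊕_) (ℤₙ.⁻¹-∙-comm j k) ⟩
    i ⊕ (⊖ (j ⊕ k))      ∎)
  ·-assoc (i , true)  (j , true)  (k , r) = cong₂ _,_ (begin
    (i ⊕ (⊖ j)) ⊕ k      ≡⟨ ⊕-assoc i (⊖ j) k ⟩
    i ⊕ ((⊖ j) ⊕ k)      ≡⟨ cong (i ⊕_) (⊕-comm (⊖ j) k) ⟩
    i ⊕ (k ⊕ (⊖ j))      ≡⟨ cong (i ⊕_) (ℤₙ.⁻¹-anti-homo-// j k) ⟨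
    i ⊕ (⊖ (j ⊕ (⊖ k)))  ∎) (sym (not-involutive r))

  ·-identityˡ : (g : D m) → εᴰ · g ≡ g
  ·-identityˡ (i , r) = cong (_, r) (⊕-identityˡ i)

  ·-identityʳ : (g : D m) → g · εᴰ ≡ g
  ·-identityʳ (i , false) = cong (_, false) (⊕-identityʳ i)
  ·-identityʳ (i , true)  = cong (_, true) (trans (cong (i ⊕_) ℤₙ.ε⁻¹≈ε) (⊕-identityʳ i))

  ·-inverseˡ : (g : D m) → inv g · g ≡ εᴰ
  ·-inverseˡ (i , false) = cong (_, false) (⊕-inverseˡ i)
  ·-inverseˡ (i , true)  = cong (_, false) (⊕-inverseʳ i)

  ·-inverseʳ : (g : D m) → g · inv g ≡ εᴰ
  ·-inverseʳ (i , false) = cong (_, false) (⊕-inverseʳ i)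
  ·-inverseʳ (i , true)  = cong (_, false) (⊕-inverseʳ i)

  Dₙ-group : Group _ _
  Dₙ-group = record
    { Carrier = D m
    ; _≈_ = _≡_
    ; _∙_ = _·_
    ; ε = εᴰ
    ; _⁻¹ = inv
    ; isGroup = record
      { isMonoid = record
        { isSemigroup = record
          { isMagma = record { isEquivalence = isEquivalence ; ∙-cong = cong₂ _·_ }
          ; assoc = ·-assoc
          }
        ; identity = ·-identityˡ , ·-identityʳ
        }
      ; inverse = ·-inverseˡ , ·-inverseʳ
      ; ⁻¹-cong = cong inv
      }
    }

  module Dₙ = GroupProperties Dₙ-group

module ℤ+ = CommutativeMonoidSum ℤP.+-0-commutativeMonoid

Σ≡sum : ∀ {n} (f : Fin n → ℤ) → Σ f ≡ ℤ+.sum f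
Σ≡sum f = trans (cong (foldr ℤ._+_ 0ℤ) (map-tabulate id f)) (foldr-tabulate f)
  where
  foldr-tabulate : ∀ {k} (g : Fin k → ℤ) → foldr ℤ._+_ 0ℤ (tabulate g) ≡ ℤ+.sum g
  foldr-tabulate {ℕ.zero} g = refl
  foldr-tabulate {suc k}  g = cong (λ s → g zero ℤ.+ s) (foldr-tabulate (g ∘ Fin.suc))

Σ-cong : ∀ {n} {f g : Fin n → ℤ} → f ≗ g → Σ f ≡ Σ g
Σ-cong {f = f} {g} f≗g = begin
  Σ f        ≡⟨ Σ≡sum f ⟩
  ℤ+.sum f   ≡⟨ ℤ+.sum-cong-≗ f≗g ⟩
  ℤ+.sum g   ≡⟨ Σ≡sum g ⟨
  Σ g        ∎

Σ-distrib-+ : ∀ {n} (f g : Fin n → ℤ) → Σ (λ i → f i ℤ.+ g i) ≡ Σ f ℤ.+ Σ g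
Σ-distrib-+ f g = begin
  Σ (λ i → f i ℤ.+ g i)      ≡⟨ Σ≡sum (λ i → f i ℤ.+ g i) ⟩
  ℤ+.sum (λ i → f i ℤ.+ g i) ≡⟨ ℤ+.∑-distrib-+ f g ⟩
  ℤ+.sum f ℤ.+ ℤ+.sum g      ≡⟨ cong₂ ℤ._+_ (Σ≡sum f) (Σ≡sum g) ⟨
  Σ f ℤ.+ Σ g                ∎

Σ-reindex : ∀ {n} (f : Fin n → ℤ) (σ τ : Fin n → Fin n) → σ ∘ τ ≗ id → τ ∘ σ ≗ id →
  Σ f ≡ Σ (f ∘ σ)
Σ-reindex f σ τ στ≗id τσ≗id = begin
  Σ f           ≡⟨ Σ≡sum f ⟩
  ℤ+.sum f      ≡⟨ ℤ+.sum-permute f (permutation σ τ στ≗id τσ≗id) ⟩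
  ℤ+.sum (f ∘ σ) ≡⟨ Σ≡sum (f ∘ σ) ⟨
  Σ (f ∘ σ)     ∎

card≡Σ : ∀ {n} (A : Subset n) → + card A ≡ Σ (λ i → [ i ∈ A ])
card≡Σ {n} A = go (allFin n)
  where
  go : (is : List (Fin n)) →
    + foldr ℕ._+_ 0 (map (λ i → if lookup A i then 1 else 0) is) ≡ foldr ℤ._+_ 0ℤ (map [_∈ A ] is)
  go []       = refl
  go (i ∷ is) with lookup A i
  ... | true  = trans (ℤP.pos-+ 1 _) (cong (λ s → 1ℤ ℤ.+ s) (go is))
  ... | false = trans (ℤP.pos-+ 0 _) (cong (λ s → 0ℤ ℤ.+ s) (go is))

module _ {m : ℕ} where

  Σ-translate : (c : Fin (suc m)) (f : Fin (suc m) → ℤ) → Σ f ≡ Σ (λ i → f (c ⊕ i))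
  Σ-translate c f = Σ-reindex f (c ⊕_) ((⊖ c) ⊕_) (ℤₙ.\\-leftDividesˡ c) (ℤₙ.\\-leftDividesʳ c)

  c⊕⊖[c⊕⊖i]≡i : (c i : Fin (suc m)) → c ⊕ (⊖ (c ⊕ (⊖ i))) ≡ i
  c⊕⊖[c⊕⊖i]≡i c i = begin
    c ⊕ (⊖ (c ⊕ (⊖ i)))  ≡⟨ cong (c ⊕_) (ℤₙ.⁻¹-anti-homo-// c i) ⟩
    c ⊕ (i ⊕ (⊖ c))      ≡⟨ cong (c ⊕_) (⊕-comm i (⊖ c)) ⟩
    c ⊕ ((⊖ c) ⊕ i)      ≡⟨ ℤₙ.\\-leftDividesˡ c i ⟩
    i                    ∎

  Σ-reflect : (c : Fin (suc m)) (f : Fin (suc m) → ℤ) → Σ f ≡ Σ (λ i → f (c ⊕ (⊖ i)))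
  Σ-reflect c f = Σ-reindex f (λ i → c ⊕ (⊖ i)) (λ i → c ⊕ (⊖ i)) (c⊕⊖[c⊕⊖i]≡i c) (c⊕⊖[c⊕⊖i]≡i c)

  ΣD-cong : {f g : D m → ℤ} → f ≗ g → ΣD f ≡ ΣD g
  ΣD-cong f≗g = cong₂ ℤ._+_ (Σ-cong (λ i → f≗g (i , false))) (Σ-cong (λ i → f≗g (i , true)))

  ΣD-translate : (g : D m) (f : D m → ℤ) → ΣD f ≡ ΣD (λ u → f (g · u))
  ΣD-translate (a , false) f =
    cong₂ ℤ._+_ (Σ-translate a (λ i → f (i , false))) (Σ-translate a (λ i → f (i , true)))
  ΣD-translate (a , true) f = trans (ℤP.+-comm (Σ (λ i → f (i , false))) (Σ (λ i → f (i , true))))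
    (cong₂ ℤ._+_ (Σ-reflect a (λ i → f (i , true))) (Σ-reflect a (λ i → f (i , false))))

  ΣD-inverse : (f : D m → ℤ) → ΣD f ≡ ΣD (f ∘ inv)
  ΣD-inverse f = cong (ℤ._+ Σ (λ i → f (i , true)))
    (Σ-reindex (λ i → f (i , false)) ⊖_ ⊖_ ℤₙ.⁻¹-involutive ℤₙ.⁻¹-involutive)

module _ {m : ℕ} where

  reflect : ZC m → ZC m
  reflect f i = f (⊖ i)

  *ᶻ-comm : (f g : ZC m) → (f *ᶻ g) ≈ (g *ᶻ f)
  *ᶻ-comm f g k = begin
    Σ (λ i → f i ℤ.* g (k ⊕ (⊖ i)))                            ≡⟨ Σ-reflect k (λ i → f i ℤ.* g (k ⊕ (⊖ i))) ⟩
    Σ (λ i → f (k ⊕ (⊖ i)) ℤ.* g (k ⊕ (⊖ (k ⊕ (⊖ i)))))        ≡⟨ Σ-cong swap ⟩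
    Σ (λ i → g i ℤ.* f (k ⊕ (⊖ i)))                            ∎
    where
    swap : (i : Fin (suc m)) → f (k ⊕ (⊖ i)) ℤ.* g (k ⊕ (⊖ (k ⊕ (⊖ i)))) ≡ g i ℤ.* f (k ⊕ (⊖ i))
    swap i = trans (cong (λ j → f (k ⊕ (⊖ i)) ℤ.* g j) (c⊕⊖[c⊕⊖i]≡i k i)) (ℤP.*-comm _ (g i))

  *ᶻ-distribˡ-+ᶻ : (f g h : ZC m) → (f *ᶻ (g +ᶻ h)) ≈ ((f *ᶻ g) +ᶻ (f *ᶻ h))
  *ᶻ-distribˡ-+ᶻ f g h k =
    trans (Σ-cong (λ i → ℤP.*-distribˡ-+ (f i) (g (k ⊕ (⊖ i))) (h (k ⊕ (⊖ i)))))
          (Σ-distrib-+ (λ i → f i ℤ.* g (k ⊕ (⊖ i))) (λ i → f i ℤ.* h (k ⊕ (⊖ i))))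

  _⋆_ : (D m → ℤ) → (D m → ℤ) → D m → ℤ
  (F ⋆ G) w = ΣD (λ u → F u ℤ.* G (inv u · w))

  rotations : (D m → ℤ) → ZC m
  rotations F i = F (i , false)

  reflections : (D m → ℤ) → ZC m
  reflections F i = F (i , true)

  ⋆-rotation : (F G : D m → ℤ) (k : Fin (suc m)) →
    (F ⋆ G) (k , false)
      ≡ ((rotations F *ᶻ rotations G) +ᶻ (reflections F *ᶻ reflect (reflections G))) k
  ⋆-rotation F G k = cong₂ ℤ._+_
    (Σ-cong (λ i → cong (λ j → F (i , false) ℤ.* G (j , false)) (⊕-comm (⊖ i) k)))
    (Σ-cong (λ i → cong (λ j → F (i , true) ℤ.* G (j , true)) (sym (ℤₙ.⁻¹-anti-homo-// k i))))

  ⋆-reflection : (F G : D m → ℤ) (k : Fin (suc m)) →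
    (F ⋆ G) (k , true)
      ≡ ((rotations F *ᶻ reflections G) +ᶻ (reflections F *ᶻ reflect (rotations G))) k
  ⋆-reflection F G k = cong₂ ℤ._+_
    (Σ-cong (λ i → cong (λ j → F (i , false) ℤ.* G (j , true)) (⊕-comm (⊖ i) k)))
    (Σ-cong (λ i → cong (λ j → F (i , true) ℤ.* G (j , false)) (sym (ℤₙ.⁻¹-anti-homo-// k i))))

  ΣD-⋆ : (F G : D m → ℤ) (g h : D m) →
    ΣD (λ z → F (inv g · z) ℤ.* G (inv z · h)) ≡ (F ⋆ G) (inv g · h)
  ΣD-⋆ F G g h = trans (ΣD-translate g (λ z → F (inv g · z) ℤ.* G (inv z · h))) (ΣD-cong λ u →
    cong₂ (λ v w → F v ℤ.* G w) (Dₙ.\\-leftDividesʳ g u) (inv[g·u]·h u))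
    where
    inv[g·u]·h : (u : D m) → inv (g · u) · h ≡ inv u · (inv g · h)
    inv[g·u]·h u = trans (cong (_· h) (Dₙ.⁻¹-anti-homo-∙ g u)) (·-assoc (inv u) (inv g) h)

module _ {m : ℕ} where

  _≟ᴰ_ : DecidableEquality (D m)
  _≟ᴰ_ = ≡-dec _≟_ Bool._≟_

  δ-refl : (g : D m) → δ g g ≡ 1ℤ
  δ-refl (i , false) rewrite dec-true (i ≟ i) refl = refl
  δ-refl (i , true)  rewrite dec-true (i ≟ i) refl = refl

  δ-≢ : {g h : D m} → g ≢ h → δ g h ≡ 0ℤ
  δ-≢ {i , s} {j , r} g≢h with i ≟ j | s | r
  ... | no _     | _     | _     = refl
  ... | yes refl | false | false = ⊥-elim (g≢h refl)
  ... | yes refl | false | true  = refl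
  ... | yes refl | true  | false = refl
  ... | yes refl | true  | true  = ⊥-elim (g≢h refl)

  δ-translate : (g h : D m) → δ g h ≡ δ εᴰ (inv g · h)
  δ-translate g h with g ≟ᴰ h
  ... | yes refl = trans (δ-refl g) (trans (sym (δ-refl εᴰ)) (cong (δ εᴰ) (sym (·-inverseˡ g))))
  ... | no g≢h   = trans (δ-≢ g≢h) (sym (δ-≢ (λ ε≡g⁻¹h → g≢h (Dₙ.⁻¹-injective
                     (Dₙ.inverseˡ-unique (inv g) h (sym ε≡g⁻¹h))))))

  δ-ε-rotation : (k : Fin (suc m)) → δ εᴰ (k , false) ≡ eᶻ k
  δ-ε-rotation k with zero ≟ k | k ≟ zero
  ... | yes _ | yes _ = refl
  ... | no _  | no _  = refl
  ... | yes p | no ¬q = ⊥-elim (¬q (sym p))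
  ... | no ¬p | yes q = ⊥-elim (¬p (sym q))

  δ-ε-reflection : (k : Fin (suc m)) → δ εᴰ (k , true) ≡ 0ℤ
  δ-ε-reflection k = δ-≢ {εᴰ} {k , true} (λ ())

module Dihedral {m : ℕ} (X Y : Subset (suc m)) where

  connection : D m → ℤ
  connection w = if inS X Y w then 1ℤ else 0ℤ

  ΣD-connection : ΣD connection ≡ + (card X + card Y)
  ΣD-connection = begin
    Σ (xbar X) ℤ.+ Σ (xbar Y)   ≡⟨ cong₂ ℤ._+_ (card≡Σ X) (card≡Σ Y) ⟨
    + card X ℤ.+ + card Y       ≡⟨ ℤP.pos-+ (card X) (card Y) ⟨
    + (card X + card Y)         ∎

  rowSum : (g : D m) → ΣD (λ h → Dih m X Y g h) ≡ + (card X + card Y)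
  rowSum g = begin
    ΣD (λ h → connection (inv g · h))          ≡⟨ ΣD-translate g (λ h → connection (inv g · h)) ⟩
    ΣD (λ u → connection (inv g · (g · u)))    ≡⟨ ΣD-cong (λ u → cong connection (Dₙ.\\-leftDividesʳ g u)) ⟩
    ΣD connection                              ≡⟨ ΣD-connection ⟩
    + (card X + card Y)                        ∎

  colSum : (h : D m) → ΣD (λ g → Dih m X Y g h) ≡ + (card X + card Y)
  colSum h = begin
    ΣD (λ g → connection (inv g · h))          ≡⟨ ΣD-translate h (λ g → connection (inv g · h)) ⟩
    ΣD (λ u → connection (inv (h · u) · h))    ≡⟨ ΣD-cong (λ u → cong connection (inv[h·u]·h u)) ⟩
    ΣD (connection ∘ inv)                      ≡⟨ ΣD-inverse connection ⟨
    ΣD connection                              ≡⟨ ΣD-connection ⟩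
    + (card X + card Y)                        ∎
    where
    inv[h·u]·h : (u : D m) → inv (h · u) · h ≡ inv u
    inv[h·u]·h u = trans (cong (_· h) (Dₙ.⁻¹-anti-homo-∙ h u)) (Dₙ.//-rightDividesˡ h (inv u))

  connection²-rotation : (k : Fin (suc m)) →
    (connection ⋆ connection) (k , false) ≡ ((xbar X *ᶻ xbar X) +ᶻ (xbar Y *ᶻ xbarNeg Y)) k
  connection²-rotation = ⋆-rotation connection connection

  connection²-reflection : (k : Fin (suc m)) →
    (connection ⋆ connection) (k , true) ≡ (xbar Y *ᶻ Δ₁ X) k
  connection²-reflection k = begin
    (connection ⋆ connection) (k , true)                  ≡⟨ ⋆-reflection connection connection k ⟩
    (xbar X *ᶻ xbar Y) k ℤ.+ (xbar Y *ᶻ xbarNeg X) k      ≡⟨ cong (λ s → s ℤ.+ (xbar Y *ᶻ xbarNeg X) k)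
                                                               (*ᶻ-comm (xbar X) (xbar Y) k) ⟩
    (xbar Y *ᶻ xbar X) k ℤ.+ (xbar Y *ᶻ xbarNeg X) k      ≡⟨ *ᶻ-distribˡ-+ᶻ (xbar Y) (xbar X) (xbarNeg X) k ⟨
    (xbar Y *ᶻ Δ₁ X) k                                    ∎

  Δ₁-Δ₂-identity : ((xbar X *ᶻ Δ₁ X) +ᶻ Δ₂ X Y) ≈ ((xbar X *ᶻ xbar X) +ᶻ (xbar Y *ᶻ xbarNeg Y))
  Δ₁-Δ₂-identity k = begin
    (xbar X *ᶻ Δ₁ X) k ℤ.+ (yȳ - xx̄)     ≡⟨ cong (ℤ._+ (yȳ - xx̄)) (*ᶻ-distribˡ-+ᶻ (xbar X) (xbar X) (xbarNeg X) k) ⟩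
    (xx ℤ.+ xx̄) ℤ.+ (yȳ - xx̄)            ≡⟨ cancel xx xx̄ yȳ ⟩
    xx ℤ.+ yȳ                           ∎
    where
    xx xx̄ yȳ : ℤ
    xx = (xbar X *ᶻ xbar X) k
    xx̄ = (xbar X *ᶻ xbarNeg X) k
    yȳ = (xbar Y *ᶻ xbarNeg Y) k
    cancel : ∀ (p q r : ℤ) → p ℤ.+ q ℤ.+ (r - q) ≡ p ℤ.+ r
    cancel = solve-∀

  module _ (μ λ' t : ℕ) where

    srgRHS : ℤ → ℤ → ℤ
    srgRHS d a = (+ t) ℤ.* d ℤ.+ (+ λ') ℤ.* a ℤ.+ (+ μ) ℤ.* (1ℤ - d - a)

    SquareCondition : Set
    SquareCondition = ∀ g h → ΣD (λ z → Dih m X Y g z ℤ.* Dih m X Y z h) ≡ srgRHS (δ g h) (Dih m X Y g h)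

    GroupRingCondition : Set
    GroupRingCondition = ∀ w → (connection ⋆ connection) w ≡ srgRHS (δ εᴰ w) (connection w)

    square⇔ : SquareCondition ⇔ GroupRingCondition
    square⇔ = mk⇔ at-identity from-identity
      where
      inv-εᴰ· : (w : D m) → inv εᴰ · w ≡ w
      inv-εᴰ· w = trans (cong (_· w) Dₙ.ε⁻¹≈ε) (·-identityˡ w)

      at-identity : SquareCondition → GroupRingCondition
      at-identity sq w = begin
        (connection ⋆ connection) w                     ≡⟨ cong (connection ⋆ connection) (inv-εᴰ· w) ⟨
        (connection ⋆ connection) (inv εᴰ · w)          ≡⟨ ΣD-⋆ connection connection εᴰ w ⟨
        ΣD (λ z → Dih m X Y εᴰ z ℤ.* Dih m X Y z w)     ≡⟨ sq εᴰ w ⟩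
        srgRHS (δ εᴰ w) (connection (inv εᴰ · w))       ≡⟨ cong (srgRHS (δ εᴰ w) ∘ connection) (inv-εᴰ· w) ⟩
        srgRHS (δ εᴰ w) (connection w)                  ∎

      from-identity : GroupRingCondition → SquareCondition
      from-identity sq g h = begin
        ΣD (λ z → Dih m X Y g z ℤ.* Dih m X Y z h)           ≡⟨ ΣD-⋆ connection connection g h ⟩
        (connection ⋆ connection) (inv g · h)                ≡⟨ sq (inv g · h) ⟩
        srgRHS (δ εᴰ (inv g · h)) (connection (inv g · h))   ≡⟨ cong (λ d → srgRHS d (Dih m X Y g h)) (δ-translate g h) ⟨
        srgRHS (δ g h) (Dih m X Y g h)                       ∎

    srgRHS-rotation : (k : Fin (suc m)) → srgRHS (δ εᴰ (k , false)) (connection (k , false))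
      ≡ ((((+ t - + μ) ·ᶻ eᶻ) +ᶻ ((+ λ' - + μ) ·ᶻ xbar X)) +ᶻ ((+ μ) ·ᶻ Cbar)) k
    srgRHS-rotation k = trans (cong (λ d → srgRHS d (xbar X k)) (δ-ε-rotation k))
      (rearrange (+ t) (+ λ') (+ μ) (eᶻ k) (xbar X k))
      where
      rearrange : ∀ (t l μ e x : ℤ) →
        t ℤ.* e ℤ.+ l ℤ.* x ℤ.+ μ ℤ.* (1ℤ - e - x) ≡ ((t - μ) ℤ.* e ℤ.+ (l - μ) ℤ.* x) ℤ.+ μ ℤ.* 1ℤ
      rearrange = solve-∀

    srgRHS-reflection : (k : Fin (suc m)) → srgRHS (δ εᴰ (k , true)) (connection (k , true))
      ≡ (((+ λ' - + μ) ·ᶻ xbar Y) +ᶻ ((+ μ) ·ᶻ Cbar)) k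
    srgRHS-reflection k = trans (cong (λ d → srgRHS d (xbar Y k)) (δ-ε-reflection k))
      (rearrange (+ t) (+ λ') (+ μ) (xbar Y k))
      where
      rearrange : ∀ (t l μ y : ℤ) →
        t ℤ.* 0ℤ ℤ.+ l ℤ.* y ℤ.+ μ ℤ.* (1ℤ - 0ℤ - y) ≡ (l - μ) ℤ.* y ℤ.+ μ ℤ.* 1ℤ
      rearrange = solve-∀

lemma4p1 : (m : ℕ) (X Y : Subset (suc m)) → lookup X zero ≡ false →
    (μ λ' t : ℕ) →
    IsDSRG (Dih m X Y) (2 * suc m) (card X + card Y) μ λ' t
      ⇔ (((xbar Y *ᶻ Δ₁ X) ≈ (((+ λ' - + μ) ·ᶻ xbar Y) +ᶻ ((+ μ) ·ᶻ Cbar)))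
        × (((xbar X *ᶻ Δ₁ X) +ᶻ Δ₂ X Y) ≈ ((xbar X *ᶻ xbar X) +ᶻ (xbar Y *ᶻ xbarNeg Y)))
        × (((xbar X *ᶻ xbar X) +ᶻ (xbar Y *ᶻ xbarNeg Y))
            ≈ ((((+ t - + μ) ·ᶻ eᶻ) +ᶻ ((+ λ' - + μ) ·ᶻ xbar X)) +ᶻ ((+ μ) ·ᶻ Cbar))))
-- The hypothesis 0 ∉ X only excludes loops; the equivalence holds without it.
lemma4p1 m X Y _ μ λ' t = mk⇔
  (λ dsrg → let sq = Equivalence.to (square⇔ μ λ' t) (IsDSRG.square dsrg) in
      (λ k → trans (sym (connection²-reflection k)) (trans (sq (k , true)) (srgRHS-reflection μ λ' t k)))
    , Δ₁-Δ₂-identity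
    , (λ k → trans (sym (connection²-rotation k)) (trans (sq (k , false)) (srgRHS-rotation μ λ' t k))))
  (λ (reflection-condition , _ , rotation-condition) → record
    { order  = refl
    ; rowSum = rowSum
    ; colSum = colSum
    ; square = Equivalence.from (square⇔ μ λ' t) λ where
        (k , false) → trans (connection²-rotation k)
          (trans (rotation-condition k) (sym (srgRHS-rotation μ λ' t k)))
        (k , true)  → trans (connection²-reflection k)
          (trans (reflection-condition k) (sym (srgRHS-reflection μ λ' t k)))
    })
  where open Dihedral X Y
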